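{- Let $p$ be a prime, $D=\{d_1,\dots,d_n\}\subset\mathbb{N}\setminus\{0\}$ finite nonempty, $d=\max D$, and $m\ge1$. Let $U\in E_D(m)$ have density $\pi=\pi(U)$, and suppose that $\Phi(U)$ contains exactly $m$ elements. Then $m\le 2d\pi-1$.
   Context: $\sigma_p(N)$ is the sum of base-$p$ digits of $N\ge0$. $E_D(m)$ is the set of $U=(u_1,\dots,u_n)\in\{0,\dots,p^m-1\}^n\setminus\{0\}$ with $\sum_iu_id_i\equiv0\pmod{p^m-1}$ and $\sum_iu_id_i>0$; $\sigma_p(U)=\sum_i\sigma_p(u_i)$ and $\pi(U)=\frac{\sigma_p(U)}{(p-1)m}$. The shift $\delta_m:\{0,\dots,p^m-1\}\to\{0,\dots,p^m-1\}$ sends $0\le N\le p^m-2$ to the residue of $pN$ modulo $p^m-1$ and $p^m-1$ to itself, extended coordinatewise to $n$-tuples. $\varphi(U)=\frac{1}{p^m-1}\sum_iu_id_i$, and $\Phi(U)=\{\varphi(\delta_m^k(U)):0\le k\le m-1\}$. -}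

module Defs where

open import Data.Nat using (ℕ; zero; suc; _+_; _*_; _∸_; _^_; _⊔_; _%_; _/_; _≡ᵇ_)
open import Data.Fin using (Fin)
import Data.Fin as Fin
open import Data.Bool using (if_then_else_)
open import Data.Integer using (+_)
open import Data.Rational using (ℚ) renaming (_/_ to _/ℚ_)
open import Data.List using (List; map; upTo)

sumF : (n : ℕ) → (Fin n → ℕ) → ℕ
sumF zero    f = 0
sumF (suc n) f = f Fin.zero + sumF n (λ i → f (Fin.suc i))

maxF : (n : ℕ) → (Fin n → ℕ) → ℕ
maxF zero    f = 0
maxF (suc n) f = f Fin.zero ⊔ maxF n (λ i → f (Fin.suc i))

-- exact rational a / b (the case b = 0 never occurs under the hypotheses)
frac : ℕ → ℕ → ℚ
frac a zero    = + 0 /ℚ 1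
frac a (suc b) = + a /ℚ suc b

-- σ_p(N): sum of base-p digits of N (fuel N suffices since p ≥ 2)
digitSumAux : ℕ → ℕ → ℕ → ℕ
digitSumAux q zero     n = 0
digitSumAux q (suc f)  n = n % suc (suc q) + digitSumAux q f (n / suc (suc q))

σ : ℕ → ℕ → ℕ
σ (suc (suc q)) N = digitSumAux q N N
σ _ N = N   -- p < 2: irrelevant (p is prime)

σU : ℕ → (n : ℕ) → (Fin n → ℕ) → ℕ
σU p n U = sumF n (λ i → σ p (U i))

density : ℕ → ℕ → (n : ℕ) → (Fin n → ℕ) → ℚ
density p m n U = frac (σU p n U) ((p ∸ 1) * m)

weight : (n : ℕ) → (Fin n → ℕ) → (Fin n → ℕ) → ℕ
weight n d U = sumF n (λ i → U i * d i)

-- δ_m on {0,…,p^m-1}: N ↦ pN mod (p^m-1) for N ≤ p^m-2, p^m-1 ↦ p^m-1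
shift : ℕ → ℕ → ℕ → ℕ
shift p m N with p ^ m ∸ 1
... | zero    = N
... | suc k   = if N ≡ᵇ suc k then N else (p * N) % suc k

shiftU : ℕ → ℕ → (n : ℕ) → (Fin n → ℕ) → (Fin n → ℕ)
shiftU p m n U i = shift p m (U i)

iter : {A : Set} → ℕ → (A → A) → A → A
iter zero    f x = x
iter (suc k) f x = f (iter k f x)

φ : ℕ → ℕ → (n : ℕ) → (Fin n → ℕ) → (Fin n → ℕ) → ℚ
φ p m n d U = frac (weight n d U) (p ^ m ∸ 1)

-- the list [φ(δ_m^k U) | k = 0,…,m-1]; Φ(U) is its set of entries
ΦList : ℕ → ℕ → (n : ℕ) → (Fin n → ℕ) → (Fin n → ℕ) → List ℚ
ΦList p m n d U = map (λ k → φ p m n d (iter k (shiftU p m n) U)) (upTo m)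

module Submission where

-- Write q = p^m - 1 and W k = Σ_i (δ_m^k u_i) d_i for the weights along the
-- δ-orbit of U.  On m-digit base-p strings δ_m is the cyclic rotation of
-- digits, so p · δ^k u = δ^(k+1) u + q · (the digit carried around); summing
-- over one period the carried digits of u add up to σ_p(u).  Hence
-- p · W k = W (k+1) + q · (carried k), every W k = c k · q is a multiple of q,
-- and telescoping over the period gives (p - 1) Σ_k c k = Σ_i σ_p(u_i) d_i
-- ≤ d σ_p(U).  Since Φ(U) = {c 0, …, c (m-1)} has m elements and U ≠ 0, the
-- c k are m distinct positive integers, so Σ_k c k ≥ m (m + 1) / 2, which is
-- (m + 1)(p - 1) m ≤ 2 d σ_p(U), i.e. the claim after dividing by (p - 1) m.

open import Defs
open import Data.Nat using (ℕ; zero; suc; _+_; _*_; _≤_; _<_; _∸_; _^_; _%_; _/_; _≡ᵇ_; NonZero; >-nonZero; z≤n; s≤s)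
import Data.Nat.Properties as NP
open import Data.Nat.DivMod using (m<n*o⇒m/o<n; m/n<m; m<n⇒m%n≡m; m<n⇒m/n≡0; [m+kn]%n≡m%n; +-distrib-/-∣ʳ; m*n/n≡m; m≡m%n+[m/n]*n; m%n<n; m/n*n≡m)
open import Data.Nat.Divisibility using (_∣_; ∣m+n∣m⇒∣n; ∣-trans; m∣m*n; n∣m*n; ∣⇒≤)
open import Data.Nat.Primality using (Prime; ¬prime[0]; ¬prime[1])
open import Data.Nat.Tactic.RingSolver using (solve-∀)
open import Data.Nat.ListAction using (sum)
open import Data.Nat.ListAction.Properties using (sum-↭)
open import Data.Integer as ℤ using (+_)
import Data.Integer.Properties as ZP
open import Data.Rational using (ℚ; toℚᵘ) renaming (_/_ to _/ℚ_; _≤_ to _≤ℚ_; _*_ to _*ℚ_; _-_ to _-ℚ_; -_ to -ℚ_)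
import Data.Rational.Properties as QP
open import Data.Rational.Unnormalised as ℚᵘ using (ℚᵘ; mkℚᵘ; ↥_; ↧_)
import Data.Rational.Unnormalised.Properties as ℚᵘP
open import Data.Fin using (Fin; toℕ) renaming (zero to fz; suc to fs)
open import Data.List using (List; []; _∷_; length; _++_; [_]; map; upTo; applyUpTo)
import Data.List.Properties as LP
open import Data.List.Relation.Unary.All as All using (All; []; _∷_)
open import Data.List.Relation.Unary.All.Properties using (++⁺; applyUpTo⁺₁)
open import Data.List.Relation.Unary.AllPairs as AllPairs using (AllPairs; []; _∷_)
import Data.List.Relation.Unary.AllPairs.Properties as AllPairsP
open import Data.List.Relation.Unary.Unique.Propositional using (Unique)
open import Data.List.Relation.Binary.Permutation.Propositional using (↭-sym; ↭⇒↭ₛ)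
open import Data.List.Relation.Binary.Permutation.Propositional.Properties using (All-resp-↭; ↭-length)
open import Data.List.Relation.Unary.Sorted.TotalOrder.Properties using (Sorted⇒AllPairs)
open import Data.List.Sort NP.≤-decTotalOrder using (sort; sort-↭; sort-↗)
open import Data.Bool using (true; false; T; if_then_else_)
open import Data.Unit using (tt)
open import Data.Empty using (⊥-elim)
open import Data.Sum using (inj₁; inj₂)
open import Data.Product using (∃; _,_)
open import Function.Definitions using (Injective)
open import Relation.Nullary using (¬_)
open import Relation.Binary.PropositionalEquality hiding ([_])
open import Data.List.Relation.Binary.Permutation.Setoid.Properties (setoid ℕ) using (Unique-resp-↭)

sumF-cong : ∀ n {f g : Fin n → ℕ} → (∀ i → f i ≡ g i) → sumF n f ≡ sumF n g
sumF-cong zero    h = refl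
sumF-cong (suc n) h = cong₂ _+_ (h fz) (sumF-cong n (λ i → h (fs i)))

sumF-+ : ∀ n (f g : Fin n → ℕ) → sumF n (λ i → f i + g i) ≡ sumF n f + sumF n g
sumF-+ zero    f g = refl
sumF-+ (suc n) f g = trans (cong (_+_ (f fz + g fz)) (sumF-+ n _ _)) (interchange (f fz) (g fz) _ _)
  where
  interchange : ∀ a b c d → a + b + (c + d) ≡ a + c + (b + d)
  interchange = solve-∀

sumF-*ˡ : ∀ c n (f : Fin n → ℕ) → c * sumF n f ≡ sumF n (λ i → c * f i)
sumF-*ˡ c zero    f = NP.*-zeroʳ c
sumF-*ˡ c (suc n) f = trans (NP.*-distribˡ-+ c _ _) (cong (_+_ (c * f fz)) (sumF-*ˡ c n _))

sumF-*ʳ : ∀ c n (f : Fin n → ℕ) → sumF n f * c ≡ sumF n (λ i → f i * c)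
sumF-*ʳ c n f = trans (NP.*-comm _ c) (trans (sumF-*ˡ c n f) (sumF-cong n (λ i → NP.*-comm c (f i))))

sumF-mono : ∀ n {f g : Fin n → ℕ} → (∀ i → f i ≤ g i) → sumF n f ≤ sumF n g
sumF-mono zero    h = z≤n
sumF-mono (suc n) h = NP.+-mono-≤ (h fz) (sumF-mono n (λ i → h (fs i)))

sumF-zero : ∀ n (f : Fin n → ℕ) → sumF n f ≡ 0 → ∀ i → f i ≡ 0
sumF-zero (suc n) f e fz     = NP.m+n≡0⇒m≡0 (f fz) e
sumF-zero (suc n) f e (fs i) = sumF-zero n _ (NP.m+n≡0⇒n≡0 (f fz) e) i

sumF-swap : ∀ m n (F : Fin n → Fin m → ℕ) →
  sumF m (λ k → sumF n (λ i → F i k)) ≡ sumF n (λ i → sumF m (F i))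
sumF-swap zero    n F = sym (sumF-zero′ n)
  where
  sumF-zero′ : ∀ n → sumF n (λ _ → 0) ≡ 0
  sumF-zero′ zero    = refl
  sumF-zero′ (suc n) = sumF-zero′ n
sumF-swap (suc m) n F = begin
  sumF n (λ i → F i fz) + sumF m (λ k → sumF n (λ i → F i (fs k)))
    ≡⟨ cong (_+_ (sumF n (λ i → F i fz))) (sumF-swap m n (λ i k → F i (fs k))) ⟩
  sumF n (λ i → F i fz) + sumF n (λ i → sumF m (λ k → F i (fs k)))
    ≡⟨ sym (sumF-+ n _ _) ⟩
  sumF n (λ i → sumF (suc m) (F i)) ∎
  where open ≡-Reasoning

maxF-ub : ∀ n (d : Fin n → ℕ) i → d i ≤ maxF n d
maxF-ub (suc n) d fz     = NP.m≤m⊔n _ _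
maxF-ub (suc n) d (fs i) = NP.≤-trans (maxF-ub n _ i) (NP.m≤n⊔m _ _)

sumTo : ℕ → (ℕ → ℕ) → ℕ
sumTo m f = sumF m (λ k → f (toℕ k))

sumTo-cong : ∀ m {f g : ℕ → ℕ} → (∀ k → f k ≡ g k) → sumTo m f ≡ sumTo m g
sumTo-cong m h = sumF-cong m (λ k → h (toℕ k))

sumTo-shift : ∀ m f → sumTo m (λ k → f (suc k)) + f 0 ≡ sumTo m f + f m
sumTo-shift zero    f = refl
sumTo-shift (suc m) f = begin
  (f 1 + S₂) + f 0 ≡⟨ rearrange (f 1) S₂ (f 0) ⟩
  f 0 + (S₂ + f 1) ≡⟨ cong (_+_ (f 0)) (sumTo-shift m (λ k → f (suc k))) ⟩
  f 0 + (S₁ + f (suc m)) ≡⟨ sym (NP.+-assoc (f 0) S₁ _) ⟩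
  f 0 + S₁ + f (suc m) ∎
  where
  open ≡-Reasoning
  S₂ = sumTo m (λ k → f (suc (suc k)))
  S₁ = sumTo m (λ k → f (suc k))
  rearrange : ∀ a b c → (a + b) + c ≡ c + (b + a)
  rearrange = solve-∀

telescope : ∀ m (V a : ℕ → ℕ) c q → (∀ k → c * V k ≡ V (suc k) + q * a k) → V m ≡ V 0 →
  c * sumTo m V ≡ sumTo m V + q * sumTo m a
telescope m V a c q step period = begin
  c * sumTo m V                                  ≡⟨ sumF-*ˡ c m _ ⟩
  sumTo m (λ k → c * V k)                        ≡⟨ sumTo-cong m step ⟩
  sumTo m (λ k → V (suc k) + q * a k)            ≡⟨ sumF-+ m _ _ ⟩
  sumTo m (λ k → V (suc k)) + sumTo m (λ k → q * a k) ≡⟨ cong₂ _+_ shifted (sym (sumF-*ˡ q m _)) ⟩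
  sumTo m V + q * sumTo m a ∎
  where
  open ≡-Reasoning
  shifted : sumTo m (λ k → V (suc k)) ≡ sumTo m V
  shifted = NP.+-cancelʳ-≡ (V 0) _ _ (trans (sumTo-shift m V) (cong (_+_ (sumTo m V)) period))

-- A strictly increasing list of length ℓ with entries ≥ b has sum at least
-- b ℓ + ℓ (ℓ - 1) / 2, since its k-th entry is at least b + k.
increasingSum : ∀ b (ys : List ℕ) → AllPairs _<_ ys → All (b ≤_) ys →
  length ys * length ys + 2 * b * length ys ≤ 2 * sum ys + length ys
increasingSum b []       _         _          = NP.≤-reflexive (NP.*-zeroʳ (2 * b))
increasingSum b (y ∷ ys) (y<ys ∷ ys↑) (b≤y ∷ b≤ys) = begin
  suc ℓ * suc ℓ + 2 * b * suc ℓ          ≡⟨ expand ℓ b ⟩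
  (ℓ * ℓ + 2 * suc b * ℓ) + (1 + 2 * b)  ≤⟨ NP.+-mono-≤ tail (NP.+-monoʳ-≤ 1 (NP.*-monoʳ-≤ 2 b≤y)) ⟩
  (2 * sum ys + ℓ) + (1 + 2 * y)         ≡⟨ collect (sum ys) ℓ y ⟩
  2 * (y + sum ys) + suc ℓ ∎
  where
  open NP.≤-Reasoning
  ℓ = length ys
  -- the remaining entries all exceed y ≥ b
  tail = increasingSum (suc b) ys ys↑ (All.map (λ y<z → NP.≤-trans (s≤s b≤y) y<z) y<ys)
  expand : ∀ l b → suc l * suc l + 2 * b * suc l ≡ (l * l + 2 * suc b * l) + (1 + 2 * b)
  expand = solve-∀
  collect : ∀ S l y → (2 * S + l) + (1 + 2 * y) ≡ 2 * (y + S) + suc l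
  collect = solve-∀

-- ℓ distinct positive naturals sum to at least 1 + 2 + ⋯ + ℓ = ℓ (ℓ + 1) / 2:
-- sorted, they form a strictly increasing list of positive numbers.
distinctSum : ∀ (ys : List ℕ) → Unique ys → All (1 ≤_) ys →
  length ys * suc (length ys) ≤ 2 * sum ys
distinctSum ys distinct positive = NP.+-cancelʳ-≤ ℓ (ℓ * suc ℓ) (2 * sum ys)
  (subst₂ _≤_ (trans (cong (λ k → k * k + 2 * 1 * k) sameLength) (square ℓ))
               (cong₂ (λ s k → 2 * s + k) (sum-↭ zs↭ys) sameLength)
    (increasingSum 1 zs increasing (All-resp-↭ (↭-sym zs↭ys) positive)))
  where
  zs = sort ys
  zs↭ys = sort-↭ ys
  ℓ = length ys
  sameLength : length zs ≡ ℓ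
  sameLength = ↭-length zs↭ys
  increasing : AllPairs _<_ zs
  increasing = AllPairs.zipWith (λ (x≤y , x≢y) → NP.≤∧≢⇒< x≤y x≢y)
    (Sorted⇒AllPairs NP.≤-totalOrder (sort-↗ ys) , Unique-resp-↭ (↭⇒↭ₛ (↭-sym zs↭ys)) distinct)
  square : ∀ l → l * l + 2 * 1 * l ≡ l * suc l + l
  square = solve-∀

distinctValues : ∀ m (c : ℕ → ℕ) → Unique (applyUpTo c m) → (∀ {k} → k < m → 1 ≤ c k) →
  m * suc m ≤ 2 * sumTo m c
distinctValues m c distinct positive =
  subst₂ (λ l s → l * suc l ≤ 2 * s) (LP.length-applyUpTo c m) (sum-applyUpTo m c)
    (distinctSum (applyUpTo c m) distinct (applyUpTo⁺₁ c m positive))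
  where
  sum-applyUpTo : ∀ m c → sum (applyUpTo c m) ≡ sumTo m c
  sum-applyUpTo zero    c = refl
  sum-applyUpTo (suc m) c = cong (_+_ (c 0)) (sum-applyUpTo m (λ k → c (suc k)))

unique-coarser : ∀ {A B C : Set} (f : A → B) (g : A → C) {xs : List A} →
  (∀ {x y} → g x ≡ g y → f x ≡ f y) → Unique (map f xs) → Unique (map g xs)
unique-coarser f g same distinct =
  AllPairsP.map⁺ (AllPairs.map (λ fx≢fy gx≡gy → fx≢fy (same gx≡gy)) (AllPairsP.map⁻ distinct))

iter-suc : ∀ {A : Set} k (f : A → A) x → iter (suc k) f x ≡ iter k f (f x)
iter-suc zero    f x = refl
iter-suc (suc k) f x = cong f (iter-suc k f x)

-- Base-p digits, for p = 2 + r.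
module BaseP (r : ℕ) where

  p : ℕ
  p = suc (suc r)

  p^-nonZero : ∀ m → NonZero (p ^ m)
  p^-nonZero m = NP.m^n≢0 p m

  -- N < p ^ N: fuel N is enough to compute all digits of N
  n<p^n : ∀ n → n < p ^ n
  n<p^n zero    = s≤s z≤n
  n<p^n (suc n) = begin-strict
    suc n           ≤⟨ n<p^n n ⟩
    p ^ n           <⟨ NP.m<m+n (p ^ n) (NP.m^n>0 p n) ⟩
    p ^ n + p ^ n   ≤⟨ NP.+-monoʳ-≤ (p ^ n) (NP.m≤m+n (p ^ n) _) ⟩
    p * p ^ n       ∎
    where open NP.≤-Reasoning

  digitSum-fuel : ∀ g f n → n < p ^ f → digitSumAux r (g + f) n ≡ digitSumAux r f n
  digitSum-fuel zero    f n n<p^f = refl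
  digitSum-fuel (suc g) f n n<p^f =
    trans (oneMore (g + f) n (NP.<-≤-trans n<p^f (NP.^-monoʳ-≤ p (NP.m≤n+m f g))))
          (digitSum-fuel g f n n<p^f)
    where
    oneMore : ∀ f n → n < p ^ f → digitSumAux r (suc f) n ≡ digitSumAux r f n
    oneMore zero    zero    _          = refl
    oneMore zero    (suc n) (s≤s ())
    oneMore (suc f) n       n<p^f      = cong (_+_ (n % p))
      (oneMore f (n / p) (m<n*o⇒m/o<n (subst (n <_) (NP.*-comm p (p ^ f)) n<p^f)))

  σ-rec : ∀ N → σ p N ≡ N % p + σ p (N / p)
  σ-rec zero    = refl
  σ-rec (suc N) = cong (_+_ (suc N % p)) (begin
      digitSumAux r N M               ≡⟨ cong (λ f → digitSumAux r f M) (sym (NP.m∸n+n≡m M≤N)) ⟩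
      digitSumAux r ((N ∸ M) + M) M   ≡⟨ digitSum-fuel (N ∸ M) M M (n<p^n M) ⟩
      digitSumAux r M M               ∎)
    where
    open ≡-Reasoning
    M = suc N / p
    M≤N : M ≤ N
    M≤N = NP.<⇒≤pred (m/n<m (suc N) p (s≤s (s≤s z≤n)))

  σ-digit : ∀ x → x < p → σ p x ≡ x
  σ-digit x x<p = trans (σ-rec x)
    (trans (cong₂ _+_ (m<n⇒m%n≡m x<p) (cong (σ p) (m<n⇒m/n≡0 x<p))) (NP.+-identityʳ x))

  σ-append : ∀ j a b → b < p ^ j → σ p (a * p ^ j + b) ≡ σ p a + σ p b
  σ-append zero    a zero    _ = trans (cong (σ p) (trans (NP.+-identityʳ _) (NP.*-identityʳ a)))
                                       (sym (NP.+-identityʳ (σ p a)))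
  σ-append zero    a (suc b) (s≤s ())
  σ-append (suc j) a b b<p^j = begin
    σ p (a * (p * P) + b)                         ≡⟨ cong (σ p) (lastDigit a p P b) ⟩
    σ p (b + (a * P) * p)                         ≡⟨ σ-rec (b + (a * P) * p) ⟩
    (b + (a * P) * p) % p + σ p ((b + (a * P) * p) / p)
      ≡⟨ cong₂ (λ x y → x + σ p y) ([m+kn]%n≡m%n b (a * P) p) quotient ⟩
    b % p + σ p (a * P + b / p)
      ≡⟨ cong (_+_ (b % p)) (σ-append j a (b / p) (m<n*o⇒m/o<n (subst (b <_) (NP.*-comm p P) b<p^j))) ⟩
    b % p + (σ p a + σ p (b / p))                 ≡⟨ swapFront (b % p) (σ p a) _ ⟩
    σ p a + (b % p + σ p (b / p))                 ≡⟨ cong (_+_ (σ p a)) (sym (σ-rec b)) ⟩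
    σ p a + σ p b ∎
    where
    open ≡-Reasoning
    P = p ^ j
    lastDigit : ∀ a p P b → a * (p * P) + b ≡ b + (a * P) * p
    lastDigit = solve-∀
    swapFront : ∀ x y z → x + (y + z) ≡ y + (x + z)
    swapFront = solve-∀
    quotient : (b + (a * P) * p) / p ≡ a * P + b / p
    quotient = trans (+-distrib-/-∣ʳ b (n∣m*n (a * P)))
                     (trans (cong (_+_ (b / p)) (m*n/n≡m (a * P) p)) (NP.+-comm (b / p) (a * P)))

  -- Digit strings, most significant digit first.

  value : List ℕ → ℕ
  value []       = 0
  value (x ∷ xs) = x * p ^ length xs + value xs

  Valid : List ℕ → Set
  Valid = All (_< p)

  value-bound : ∀ xs → Valid xs → value xs < p ^ length xs
  value-bound []       []           = s≤s z≤n
  value-bound (x ∷ xs) (x<p ∷ xs<p) = begin-strict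
    x * P + value xs   <⟨ NP.+-monoʳ-< (x * P) (value-bound xs xs<p) ⟩
    x * P + P          ≡⟨ NP.+-comm (x * P) P ⟩
    suc x * P          ≤⟨ NP.*-monoˡ-≤ P x<p ⟩
    p * P              ∎
    where
    open NP.≤-Reasoning
    P = p ^ length xs

  value-snoc : ∀ xs y → value (xs ++ [ y ]) ≡ p * value xs + y
  value-snoc []       y = trans (trans (NP.+-identityʳ _) (NP.*-identityʳ y))
                                (sym (cong (_+ y) (NP.*-zeroʳ p)))
  value-snoc (x ∷ xs) y = begin
    x * p ^ length (xs ++ [ y ]) + value (xs ++ [ y ])
      ≡⟨ cong₂ (λ l v → x * p ^ l + v) (trans (LP.length-++ xs) (NP.+-comm (length xs) 1)) (value-snoc xs y) ⟩
    x * (p * p ^ length xs) + (p * value xs + y)   ≡⟨ factor p x (p ^ length xs) (value xs) y ⟩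
    p * (x * p ^ length xs + value xs) + y         ∎
    where
    open ≡-Reasoning
    factor : ∀ p x P v y → x * (p * P) + (p * v + y) ≡ p * (x * P + v) + y
    factor = solve-∀

  σ-value : ∀ xs → Valid xs → σ p (value xs) ≡ sum xs
  σ-value []       []           = refl
  σ-value (x ∷ xs) (x<p ∷ xs<p) =
    trans (σ-append (length xs) x (value xs) (value-bound xs xs<p))
          (cong₂ _+_ (σ-digit x x<p) (σ-value xs xs<p))

  digits : ℕ → ℕ → List ℕ
  digits zero    u = []
  digits (suc m) u = u / p ^ m ∷ digits m (u % p ^ m)
    where instance _ = p^-nonZero m

  digits-length : ∀ m u → length (digits m u) ≡ m
  digits-length zero    u = refl
  digits-length (suc m) u = cong suc (digits-length m _)

  digits-valid : ∀ m u → u < p ^ m → Valid (digits m u)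
  digits-valid zero    u _      = []
  digits-valid (suc m) u u<p^m  = m<n*o⇒m/o<n u<p^m ∷ digits-valid m _ (m%n<n u (p ^ m))
    where instance _ = p^-nonZero m

  value-digits : ∀ m u → u < p ^ m → value (digits m u) ≡ u
  value-digits zero    zero    _        = refl
  value-digits zero    (suc u) (s≤s ())
  value-digits (suc m) u       u<p^m    = begin
    (u / P) * p ^ length (digits m (u % P)) + value (digits m (u % P))
      ≡⟨ cong₂ (λ l v → (u / P) * p ^ l + v) (digits-length m _) (value-digits m (u % P) (m%n<n u P)) ⟩
    (u / P) * P + u % P   ≡⟨ NP.+-comm _ (u % P) ⟩
    u % P + (u / P) * P   ≡⟨ sym (m≡m%n+[m/n]*n u P) ⟩
    u                     ∎
    where
    open ≡-Reasoning
    P = p ^ m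
    instance _ = p^-nonZero m

  rotate : List ℕ → List ℕ
  rotate []       = []
  rotate (x ∷ xs) = xs ++ [ x ]

  leading : List ℕ → ℕ
  leading []      = 0
  leading (x ∷ _) = x

  rotate-length : ∀ xs → length (rotate xs) ≡ length xs
  rotate-length []       = refl
  rotate-length (x ∷ xs) = trans (LP.length-++ xs) (NP.+-comm (length xs) 1)

  rotate-valid : ∀ {xs} → Valid xs → Valid (rotate xs)
  rotate-valid []          = []
  rotate-valid (x<p ∷ xs<p) = ++⁺ xs<p (x<p ∷ [])

  rotate-value : ∀ xs Q → p ^ length xs ≡ suc Q → p * value xs ≡ value (rotate xs) + Q * leading xs
  rotate-value []       Q _  = trans (NP.*-zeroʳ p) (sym (NP.*-zeroʳ Q))
  rotate-value (x ∷ xs) Q pˡ = begin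
    p * (x * P + value xs)        ≡⟨ expand p x P (value xs) ⟩
    x * (p * P) + p * value xs    ≡⟨ cong (λ z → x * z + p * value xs) pˡ ⟩
    x * suc Q + p * value xs      ≡⟨ regroup p x (value xs) Q ⟩
    (p * value xs + x) + Q * x    ≡⟨ cong (_+ Q * x) (sym (value-snoc xs x)) ⟩
    value (xs ++ [ x ]) + Q * x   ∎
    where
    open ≡-Reasoning
    P = p ^ length xs
    expand : ∀ p x P v → p * (x * P + v) ≡ x * (p * P) + p * v
    expand = solve-∀
    regroup : ∀ p x v Q → x * suc Q + p * v ≡ (p * v + x) + Q * x
    regroup = solve-∀

  rotate-block : ∀ xs ys → iter (length xs) rotate (xs ++ ys) ≡ ys ++ xs
  rotate-block []       ys = sym (LP.++-identityʳ ys)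
  rotate-block (x ∷ xs) ys = begin
    iter (suc (length xs)) rotate (x ∷ (xs ++ ys))  ≡⟨ iter-suc (length xs) rotate _ ⟩
    iter (length xs) rotate ((xs ++ ys) ++ [ x ])   ≡⟨ cong (iter (length xs) rotate) (LP.++-assoc xs ys [ x ]) ⟩
    iter (length xs) rotate (xs ++ (ys ++ [ x ]))   ≡⟨ rotate-block xs (ys ++ [ x ]) ⟩
    (ys ++ [ x ]) ++ xs                              ≡⟨ LP.++-assoc ys [ x ] xs ⟩
    ys ++ x ∷ xs                                     ∎
    where open ≡-Reasoning

  leading-sum : ∀ xs ys → sumTo (length xs) (λ k → leading (iter k rotate (xs ++ ys))) ≡ sum xs
  leading-sum []       ys = refl
  leading-sum (x ∷ xs) ys = cong (_+_ x) (trans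
    (sumTo-cong (length xs) (λ k → cong leading
      (trans (iter-suc k rotate _) (cong (iter k rotate) (LP.++-assoc xs ys [ x ])))))
    (leading-sum xs (ys ++ [ x ])))

  -- The shift δ_m.  Write p ^ m = Q + 1.  If p · N = V + Q · x with N, V ≤ Q
  -- and x a digit, then δ_m N = V; this is how rotation of digits acts.

  -- on the fixed point N = Q the relation forces V = Q, since V + Q·x ≤ Q·p
  saturated : ∀ Q x V → x < p → V ≤ Q → p * Q ≡ V + Q * x → V ≡ Q
  saturated Q x V x<p V≤Q rel = NP.≤-antisym V≤Q (NP.≮⇒≥ V≮Q)
    where
    V≮Q : ¬ V < Q
    V≮Q V<Q = NP.<-irrefl (sym rel) (begin-strict
      V + Q * x       <⟨ NP.+-monoˡ-< (Q * x) V<Q ⟩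
      Q + Q * x       ≤⟨ NP.+-monoʳ-≤ Q (NP.*-monoʳ-≤ Q (NP.≤-pred x<p)) ⟩
      Q + Q * suc r   ≡⟨ cong (_+_ Q) (NP.*-comm Q (suc r)) ⟩
      p * Q           ∎)
      where open NP.≤-Reasoning

  -- below the fixed point V = Q is impossible: it would give Q ∣ (Q + 1) · N,
  -- hence Q ∣ N with 0 < N < Q
  belowTop : ∀ m N Q x → p ^ suc m ≡ suc Q → N < Q → p * N ≢ Q + Q * x
  belowTop m zero    (suc Q) x _   _   rel with trans (sym (NP.*-zeroʳ p)) rel
  ... | ()
  belowTop m (suc n) Q       x top N<Q rel = NP.<⇒≱ N<Q (∣⇒≤ Q∣N)
    where
    N = suc n
    P = p ^ m
    multiple : Q * N + N ≡ Q * (P * (1 + x))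
    multiple = begin
      Q * N + N          ≡⟨ NP.+-comm (Q * N) N ⟩
      suc Q * N          ≡⟨ cong (_* N) (sym top) ⟩
      (p * P) * N        ≡⟨ reassoc p P N ⟩
      P * (p * N)        ≡⟨ cong (P *_) rel ⟩
      P * (Q + Q * x)    ≡⟨ regroup P Q x ⟩
      Q * (P * (1 + x))  ∎
      where
      open ≡-Reasoning
      reassoc : ∀ p P N → (p * P) * N ≡ P * (p * N)
      reassoc = solve-∀
      regroup : ∀ P Q x → P * (Q + Q * x) ≡ Q * (P * (1 + x))
      regroup = solve-∀
    Q∣N : Q ∣ N
    Q∣N = ∣m+n∣m⇒∣n (subst (Q ∣_) (sym multiple) (m∣m*n _)) (m∣m*n N)

  shift-unfold : ∀ m N k → p ^ m ∸ 1 ≡ suc k →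
    shift p m N ≡ (if N ≡ᵇ suc k then N else (p * N) % suc k)
  shift-unfold m N k q≡ rewrite q≡ = refl

  shift-step : ∀ m k N V x → p ^ suc m ≡ suc (suc k) → N ≤ suc k → V ≤ suc k → x < p →
    p * N ≡ V + suc k * x → shift p (suc m) N ≡ V
  shift-step m k N V x top N≤Q V≤Q x<p rel =
    trans (shift-unfold (suc m) N k (cong (_∸ 1) top)) cases
    where
    Q = suc k
    cases : (if N ≡ᵇ Q then N else (p * N) % Q) ≡ V
    cases with N ≡ᵇ Q in isTop
    ... | true  = trans N≡Q (sym (saturated Q x V x<p V≤Q (subst (λ z → p * z ≡ V + Q * x) N≡Q rel)))
      where
      N≡Q : N ≡ Q
      N≡Q = NP.≡ᵇ⇒≡ N Q (subst T (sym isTop) tt)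
    ... | false = begin
      (p * N) % Q            ≡⟨ cong (_% Q) (trans rel (cong (_+_ V) (NP.*-comm Q x))) ⟩
      (V + x * Q) % Q        ≡⟨ [m+kn]%n≡m%n V x Q ⟩
      V % Q                  ≡⟨ m<n⇒m%n≡m V<Q ⟩
      V                      ∎
      where
      open ≡-Reasoning
      N<Q : N < Q
      N<Q = NP.≤∧≢⇒< N≤Q (λ N≡Q → subst T isTop (NP.≡⇒≡ᵇ N Q N≡Q))
      V<Q : V < Q
      V<Q = NP.≤∧≢⇒< V≤Q (λ V≡Q → belowTop m N Q x top N<Q (subst (λ z → p * N ≡ z + Q * x) V≡Q rel))

  shift-rotate : ∀ m ds → length ds ≡ suc m → Valid ds → shift p (suc m) (value ds) ≡ value (rotate ds)
  shift-rotate m []       ()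
  shift-rotate m (x ∷ xs) len valid@(x<p ∷ _) =
    shift-step m k (value (x ∷ xs)) (value (rotate (x ∷ xs))) x top
      (below (x ∷ xs) len valid)
      (below (rotate (x ∷ xs)) (trans (rotate-length (x ∷ xs)) len) (rotate-valid valid))
      x<p
      (rotate-value (x ∷ xs) (suc k) (trans (cong (p ^_) len) top))
    where
    k = p ^ suc m ∸ 2
    top : p ^ suc m ≡ suc (suc k)
    top = sym (NP.m+[n∸m]≡n (NP.≤-trans (s≤s (s≤s z≤n)) (NP.m≤m*n p (p ^ m) {{p^-nonZero m}})))
    below : ∀ ys → length ys ≡ suc m → Valid ys → value ys ≤ suc k
    below ys l v = NP.≤-pred (subst (value ys <_) (trans (cong (p ^_) l) top) (value-bound ys v))

  module Orbit (m' u : ℕ) (u<p^m : u < p ^ suc m') where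

    m q : ℕ
    m = suc m'
    q = p ^ m ∸ 1

    p^m≡1+q : p ^ m ≡ suc q
    p^m≡1+q = trans (sym (NP.m∸n+n≡m (NP.m^n>0 p m))) (NP.+-comm q 1)

    rotation : ℕ → List ℕ
    rotation k = iter k rotate (digits m u)

    rotation-length : ∀ k → length (rotation k) ≡ m
    rotation-length zero    = digits-length m u
    rotation-length (suc k) = trans (rotate-length (rotation k)) (rotation-length k)

    rotation-valid : ∀ k → Valid (rotation k)
    rotation-valid zero    = digits-valid m u u<p^m
    rotation-valid (suc k) = rotate-valid (rotation-valid k)

    orbit : ℕ → ℕ
    orbit k = iter k (shift p m) u

    -- the digit carried around by the k-th application of δ_m
    carry : ℕ → ℕ
    carry k = leading (rotation k)

    orbit-digits : ∀ k → orbit k ≡ value (rotation k)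
    orbit-digits zero    = sym (value-digits m u u<p^m)
    orbit-digits (suc k) = trans (cong (shift p m) (orbit-digits k))
                                 (shift-rotate m' (rotation k) (rotation-length k) (rotation-valid k))

    orbit-step : ∀ k → p * orbit k ≡ orbit (suc k) + q * carry k
    orbit-step k = begin
      p * orbit k                            ≡⟨ cong (p *_) (orbit-digits k) ⟩
      p * value (rotation k)                 ≡⟨ rotate-value (rotation k) q p^length≡1+q ⟩
      value (rotation (suc k)) + q * carry k ≡⟨ cong (_+ q * carry k) (sym (orbit-digits (suc k))) ⟩
      orbit (suc k) + q * carry k            ∎
      where
      open ≡-Reasoning
      p^length≡1+q : p ^ length (rotation k) ≡ suc q
      p^length≡1+q = trans (cong (p ^_) (rotation-length k)) p^m≡1+q

    rotation-period : rotation m ≡ digits m u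
    rotation-period = begin
      iter m rotate ds                          ≡⟨ cong (λ l → iter l rotate ds) (sym (digits-length m u)) ⟩
      iter (length ds) rotate ds                ≡⟨ cong (iter (length ds) rotate) (sym (LP.++-identityʳ ds)) ⟩
      iter (length ds) rotate (ds ++ [])        ≡⟨ rotate-block ds [] ⟩
      ds                                        ∎
      where
      open ≡-Reasoning
      ds = digits m u

    orbit-period : orbit m ≡ u
    orbit-period = trans (orbit-digits m) (trans (cong value rotation-period) (value-digits m u u<p^m))

    carry-sum : sumTo m carry ≡ σ p u
    carry-sum = begin
      sumTo m carry                                                ≡⟨ cong (λ l → sumTo l carry) (sym (digits-length m u)) ⟩
      sumTo (length ds) carry                                      ≡⟨ sumTo-cong (length ds) padded ⟩
      sumTo (length ds) (λ k → leading (iter k rotate (ds ++ []))) ≡⟨ leading-sum ds [] ⟩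
      sum ds                                                       ≡⟨ sym (σ-value ds (digits-valid m u u<p^m)) ⟩
      σ p (value ds)                                               ≡⟨ cong (σ p) (value-digits m u u<p^m) ⟩
      σ p u                                                        ∎
      where
      open ≡-Reasoning
      ds = digits m u
      padded : ∀ k → carry k ≡ leading (iter k rotate (ds ++ []))
      padded k = cong (λ z → leading (iter k rotate z)) (sym (LP.++-identityʳ ds))

    -- 0 is fixed by δ_m, so an orbit through 0 within one period starts at 0
    orbit-zero : ∀ k → k ≤ m → orbit k ≡ 0 → u ≡ 0
    orbit-zero k k≤m orbitₖ≡0 =
      trans (sym orbit-period) (subst (λ j → orbit j ≡ 0) (NP.m∸n+n≡m k≤m) (stays (m ∸ k)))
      where
      stays : ∀ j → orbit (j + k) ≡ 0
      stays zero    = orbitₖ≡0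
      stays (suc j) = NP.m+n≡0⇒m≡0 (orbit (suc (j + k)))
        (trans (sym (orbit-step (j + k))) (trans (cong (p *_) (stays j)) (NP.*-zeroʳ p)))

module WeightedOrbit (r m' n : ℕ) (d : Fin n → ℕ) (U : Fin n → ℕ)
                     (U<p^m : ∀ i → U i < BaseP.p r ^ suc m') where
  open BaseP r
  module Coord (i : Fin n) = Orbit m' (U i) (U<p^m i)

  m q : ℕ
  m = suc m'
  q = p ^ m ∸ 1

  W : ℕ → ℕ
  W k = sumF n (λ i → Coord.orbit i k * d i)

  carried : ℕ → ℕ
  carried k = sumF n (λ i → Coord.carry i k * d i)

  weight-iter : ∀ k → weight n d (iter k (shiftU p m n) U) ≡ W k
  weight-iter k = sumF-cong n (λ i → cong (_* d i) (iter-coordinate k i))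
    where
    iter-coordinate : ∀ k i → iter k (shiftU p m n) U i ≡ iter k (shift p m) (U i)
    iter-coordinate zero    i = refl
    iter-coordinate (suc k) i = cong (shift p m) (iter-coordinate k i)

  W-step : ∀ k → p * W k ≡ W (suc k) + q * carried k
  W-step k = begin
    p * W k                                                  ≡⟨ sumF-*ˡ p n _ ⟩
    sumF n (λ i → p * (Coord.orbit i k * d i))               ≡⟨ sumF-cong n termwise ⟩
    sumF n (λ i → Coord.orbit i (suc k) * d i + q * (Coord.carry i k * d i)) ≡⟨ sumF-+ n _ _ ⟩
    W (suc k) + sumF n (λ i → q * (Coord.carry i k * d i))   ≡⟨ cong (_+_ (W (suc k))) (sym (sumF-*ˡ q n _)) ⟩
    W (suc k) + q * carried k                                ∎
    where
    open ≡-Reasoning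
    termwise : ∀ i → p * (Coord.orbit i k * d i) ≡ Coord.orbit i (suc k) * d i + q * (Coord.carry i k * d i)
    termwise i = trans (sym (NP.*-assoc p (Coord.orbit i k) (d i)))
      (trans (cong (_* d i) (Coord.orbit-step i k)) (distribute (Coord.orbit i (suc k)) q (Coord.carry i k) (d i)))
      where
      distribute : ∀ v' q a e → (v' + q * a) * e ≡ v' * e + q * (a * e)
      distribute = solve-∀

  W-period : W m ≡ W 0
  W-period = sumF-cong n (λ i → cong (_* d i) (Coord.orbit-period i))

  carried-sum : sumTo m carried ≡ sumF n (λ i → σ p (U i) * d i)
  carried-sum = trans (sumF-swap m n (λ i k → Coord.carry i (toℕ k) * d i)) (sumF-cong n (λ i →
    trans (sym (sumF-*ʳ (d i) m (λ k → Coord.carry i (toℕ k)))) (cong (_* d i) (Coord.carry-sum i))))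

  q-positive : 1 ≤ q
  q-positive = NP.∸-monoˡ-≤ 1 (NP.≤-trans (s≤s (s≤s z≤n)) (NP.m≤m*n p (p ^ m') {{p^-nonZero m'}}))

  instance
    q-nonZero : NonZero q
    q-nonZero = >-nonZero q-positive

  -- divisibility of W 0 by q propagates along the orbit through W-step
  W-divisible : q ∣ W 0 → ∀ k → q ∣ W k
  W-divisible q∣W₀ zero    = q∣W₀
  W-divisible q∣W₀ (suc k) = ∣m+n∣m⇒∣n
    (subst (q ∣_) (trans (W-step k) (NP.+-comm (W (suc k)) _)) (∣-trans (W-divisible q∣W₀ k) (n∣m*n p)))
    (m∣m*n (carried k))

  -- Since U ∈ E_D(m), every W k = c k · q with c k = φ (δ^k U) a natural number.
  module Quotients (q∣W₀ : q ∣ W 0) where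

    c : ℕ → ℕ
    c k = W k / q

    W≡c*q : ∀ k → W k ≡ c k * q
    W≡c*q k = sym (m/n*n≡m (W-divisible q∣W₀ k))

    quotient-sum : suc r * sumTo m c ≡ sumF n (λ i → σ p (U i) * d i)
    quotient-sum = NP.+-cancelˡ-≡ C _ _ (NP.*-cancelʳ-≡ _ _ q (begin
      (p * C) * q                      ≡⟨ NP.*-assoc p C q ⟩
      p * (C * q)                      ≡⟨ cong (p *_) (sym ΣW) ⟩
      p * sumTo m W                    ≡⟨ telescope m W carried p q W-step W-period ⟩
      sumTo m W + q * sumTo m carried  ≡⟨ cong₂ (λ x y → x + q * y) ΣW carried-sum ⟩
      C * q + q * Qs                   ≡⟨ factor C q Qs ⟩
      (C + Qs) * q                     ∎))
      where
      open ≡-Reasoning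
      C  = sumTo m c
      Qs = sumF n (λ i → σ p (U i) * d i)
      ΣW : sumTo m W ≡ C * q
      ΣW = trans (sumTo-cong m W≡c*q) (sym (sumF-*ʳ q m (λ k → c (toℕ k))))
      factor : ∀ a q b → a * q + q * b ≡ (a + b) * q
      factor = solve-∀

    -- an orbit of U ≠ 0 never reaches 0, so every c k is positive
    c-positive : (∃ λ i → U i ≢ 0) → (∀ i → 1 ≤ d i) → ∀ {k} → k < m → 1 ≤ c k
    c-positive (i , Uᵢ≢0) d-positive {k} k<m with c k in cₖ≡
    ... | suc _ = s≤s z≤n
    ... | zero  = ⊥-elim (Uᵢ≢0 (Coord.orbit-zero i k (NP.<⇒≤ k<m) orbitᵢ≡0))
      where
      termᵢ≡0 : Coord.orbit i k * d i ≡ 0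
      termᵢ≡0 = sumF-zero n _ (trans (W≡c*q k) (cong (_* q) cₖ≡)) i
      orbitᵢ≡0 : Coord.orbit i k ≡ 0
      orbitᵢ≡0 with NP.m*n≡0⇒m≡0∨n≡0 (Coord.orbit i k) termᵢ≡0
      ... | inj₁ orbit≡0 = orbit≡0
      ... | inj₂ dᵢ≡0    = ⊥-elim (NP.<⇒≢ (d-positive i) (sym dᵢ≡0))

    -- Φ(U) lists φ (δ^k U) = W k / q = c k, so if its m entries are distinct,
    -- so are c 0, …, c (m-1)
    c-distinct : Unique (ΦList p m n d U) → Unique (applyUpTo c m)
    c-distinct distinct = subst Unique (LP.map-upTo c m)
      (unique-coarser φₖ c {upTo m} (λ {a} {b} → same-φ {a} {b}) distinct)
      where
      φₖ : ℕ → ℚ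
      φₖ k = φ p m n d (iter k (shiftU p m n) U)
      same-φ : ∀ {a b} → c a ≡ c b → φₖ a ≡ φₖ b
      same-φ {a} {b} same-c = cong (λ w → frac w q) (begin
        weight n d (iter a (shiftU p m n) U)  ≡⟨ weight-iter a ⟩
        W a                                   ≡⟨ W≡c*q a ⟩
        c a * q                               ≡⟨ cong (_* q) same-c ⟩
        c b * q                               ≡⟨ sym (W≡c*q b) ⟩
        W b                                   ≡⟨ sym (weight-iter b) ⟩
        weight n d (iter b (shiftU p m n) U)  ∎)
        where open ≡-Reasoning

  orbitBound : (∃ λ i → U i ≢ 0) → (∀ i → 1 ≤ d i) → q ∣ weight n d U →
    Unique (ΦList p m n d U) →
    suc m * (suc r * m) ≤ 2 * maxF n d * σU p n U
  orbitBound nonzero d-positive q∣W₀ distinct = begin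
    suc m * (suc r * m)                  ≡⟨ regroup m (suc r) ⟩
    suc r * (m * suc m)                  ≤⟨ NP.*-monoʳ-≤ (suc r) triangular ⟩
    suc r * (2 * sumTo m c)              ≡⟨ swapFactors (suc r) 2 (sumTo m c) ⟩
    2 * (suc r * sumTo m c)              ≡⟨ cong (2 *_) quotient-sum ⟩
    2 * sumF n (λ i → σ p (U i) * d i)   ≤⟨ NP.*-monoʳ-≤ 2 weightedDigits ⟩
    2 * (σU p n U * maxF n d)            ≡⟨ cong (2 *_) (NP.*-comm (σU p n U) (maxF n d)) ⟩
    2 * (maxF n d * σU p n U)            ≡⟨ sym (NP.*-assoc 2 (maxF n d) (σU p n U)) ⟩
    2 * maxF n d * σU p n U              ∎
    where
    open NP.≤-Reasoning
    open Quotients q∣W₀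
    triangular : m * suc m ≤ 2 * sumTo m c
    triangular = distinctValues m c (c-distinct distinct) (c-positive nonzero d-positive)
    weightedDigits : sumF n (λ i → σ p (U i) * d i) ≤ σU p n U * maxF n d
    weightedDigits = NP.≤-trans (sumF-mono n (λ i → NP.*-monoʳ-≤ (σ p (U i)) (maxF-ub n d i)))
                                (NP.≤-reflexive (sym (sumF-*ʳ (maxF n d) n _)))
    regroup : ∀ m a → suc m * (a * m) ≡ a * (m * suc m)
    regroup = solve-∀
    swapFactors : ∀ a b c → a * (b * c) ≡ b * (a * c)
    swapFactors = solve-∀

bound : ℕ → ℕ → ℕ → ℚᵘ
bound D s t = (mkℚᵘ (+ (2 * D)) 0 ℚᵘ.* mkℚᵘ (+ s) t) ℚᵘ.- mkℚᵘ (+ 1) 0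

bound-denominator : ∀ D s t → ↧ bound D s t ≡ + suc t
bound-denominator D s t = cong (λ z → + suc z) (trans (NP.*-identityʳ _) (NP.+-identityʳ t))

bound-numerator : ∀ D s t → suc t ≤ 2 * D * s → ↥ bound D s t ≡ + (2 * D * s ∸ suc t)
bound-numerator D s t t<2Ds = begin
  (+ (2 * D) ℤ.* + s) ℤ.* + 1 ℤ.+ (ℤ.- + 1) ℤ.* + suc (t + 0)
    ≡⟨ cong₂ ℤ._+_ (trans (ZP.*-identityʳ _) (sym (ZP.pos-* (2 * D) s)))
                   (trans (ZP.-1*i≡-i _) (cong (λ z → ℤ.- + suc z) (NP.+-identityʳ t))) ⟩
  + (2 * D * s) ℤ.- + suc t  ≡⟨ ZP.m-n≡m⊖n (2 * D * s) (suc t) ⟩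
  (2 * D * s) ℤ.⊖ suc t     ≡⟨ ZP.⊖-≥ t<2Ds ⟩
  + (2 * D * s ∸ suc t)     ∎
  where open ≡-Reasoning

boundᵘ : ∀ m D s t → suc m * suc t ≤ 2 * D * s → mkℚᵘ (+ m) 0 ℚᵘ.≤ bound D s t
boundᵘ m D s t hyp = ℚᵘ.*≤* (subst₂ ℤ._≤_
    (trans (ZP.pos-* m (suc t)) (cong (+ m ℤ.*_) (sym (bound-denominator D s t))))
    (trans (sym (ZP.*-identityʳ _)) (cong (ℤ._* + 1) (sym (bound-numerator D s t t<2Ds))))
    (ℤ.+≤+ remainder))
  where
  t<2Ds : suc t ≤ 2 * D * s
  t<2Ds = NP.≤-trans (NP.m≤m+n (suc t) (m * suc t)) hyp
  remainder : m * suc t ≤ 2 * D * s ∸ suc t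
  remainder = NP.≤-trans (NP.≤-reflexive (sym (NP.m+n∸m≡n (suc t) (m * suc t))))
                         (NP.∸-monoˡ-≤ (suc t) hyp)

rationalBound : ∀ m D s t → suc m * suc t ≤ 2 * D * s →
  (+ m /ℚ 1) ≤ℚ ((+ (2 * D) /ℚ 1) *ℚ (+ s /ℚ suc t)) -ℚ (+ 1 /ℚ 1)
rationalBound m D s t hyp = QP.toℚᵘ-cancel-≤
  (ℚᵘP.≤-respˡ-≃ (ℚᵘP.≃-sym (QP.toℚᵘ-fromℚᵘ (mkℚᵘ (+ m) 0)))
    (ℚᵘP.≤-respʳ-≃ (ℚᵘP.≃-sym normalised) (boundᵘ m D s t hyp)))
  where
  A = + (2 * D) /ℚ 1
  B = + s /ℚ suc t
  C = + 1 /ℚ 1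
  normalised : toℚᵘ ((A *ℚ B) -ℚ C) ℚᵘ.≃ bound D s t
  normalised = ℚᵘP.≃-trans (QP.toℚᵘ-homo-+ (A *ℚ B) (-ℚ C))
    (ℚᵘP.+-cong (ℚᵘP.≃-trans (QP.toℚᵘ-homo-* A B)
                  (ℚᵘP.*-cong (QP.toℚᵘ-fromℚᵘ (mkℚᵘ (+ (2 * D)) 0)) (QP.toℚᵘ-fromℚᵘ (mkℚᵘ (+ s) t))))
                (ℚᵘP.≃-trans (QP.toℚᵘ-homo‿- C) (ℚᵘP.-‿cong (QP.toℚᵘ-fromℚᵘ (mkℚᵘ (+ 1) 0)))))

-- The theorem.
mainTheorem12 : (p : ℕ) → Prime p →
    (n : ℕ) → 1 ≤ n → (d : Fin n → ℕ) → Injective _≡_ _≡_ d → (∀ i → 1 ≤ d i) →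
    (m : ℕ) → 1 ≤ m →
    (U : Fin n → ℕ) → (∀ i → U i < p ^ m) → ∃ (λ i → U i ≢ 0) →
    (p ^ m ∸ 1) ∣ weight n d U → 1 ≤ weight n d U →
    Unique (ΦList p m n d U) →
    (+ m /ℚ 1) ≤ℚ ((+ (2 * maxF n d) /ℚ 1) *ℚ density p m n U) -ℚ (+ 1 /ℚ 1)
mainTheorem12 zero          p-prime = ⊥-elim (¬prime[0] p-prime)
mainTheorem12 (suc zero)    p-prime = ⊥-elim (¬prime[1] p-prime)
mainTheorem12 (suc (suc r)) _ n _ d _ d-positive zero ()
mainTheorem12 (suc (suc r)) _ n _ d _ d-positive (suc m') _ U U<p^m nonzero q∣W _ distinct =
  -- density p m n U = σ_p(U) / ((p - 1) m) with (p - 1) m = 1 + (m' + r (m' + 1))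
  rationalBound (suc m') (maxF n d) (σU (suc (suc r)) n U) (m' + r * suc m')
    (WeightedOrbit.orbitBound r m' n d U U<p^m nonzero d-positive q∣W distinct)
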